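{- Let $n,m\ge 2$ and $l>1$ be natural numbers such that $x^n\equiv 1 \pmod l$ for every nonnegative integer $x$ not divisible by $l$. If $m<l$, then for every nonnegative integer $b$ and every $s\in\mathbb{N}$, $$P\Big(\sum_{i=1}^m x_i^n=b\,(l^s)^n\Big)=P\Big(\sum_{i=1}^m x_i^n=b\Big).$$
   Context: $P(f(x_1,\dots,x_m)=d)$ denotes the number of solutions $(x_1,\dots,x_m)$ in nonnegative integers. -}

module Defs where

open import Data.Nat using (ℕ; zero; suc; _+_; _^_; _≟_)
open import Data.List using (List; []; _∷_; [_]; map; concatMap; upTo; length; filter)
open import Data.Vec using (Vec; []; _∷_)

powSum : ∀ {m} → ℕ → Vec ℕ m → ℕ
powSum n []       = 0
powSum n (x ∷ xs) = x ^ n + powSum n xs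

boxVecs : (m B : ℕ) → List (Vec ℕ m)
boxVecs zero    B = [ [] ]
boxVecs (suc m) B = concatMap (λ x → map (x ∷_) (boxVecs m B)) (upTo (suc B))

-- P(Σ_{i=1}^m x_i^n = d): number of (x_1,…,x_m) ∈ ℕ^m with Σ x_i^n = d.
-- For n ≥ 1 every solution satisfies x_i ≤ x_i^n ≤ d, so enumerating the
-- box {0,…,d}^m counts all solutions exactly.
P : (n m d : ℕ) → ℕ
P n m d = length (filter (λ v → powSum n v ≟ d) (boxVecs m d))

-- If l ∤ x then x ^ n ≡ 1 (mod l), so Σ xᵢ ^ n is congruent mod l to the number of entries
-- not divisible by l. With fewer than l entries, a sum divisible by l therefore has only
-- multiples of l as entries, and x ↦ l x maps the solutions of Σ xᵢ ^ n = b bijectively onto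
-- those of Σ xᵢ ^ n = b l ^ n. We count by recursion on the number of entries: the range of the
-- first entry splits into blocks of length l, of which only the block starts contribute.
module Submission where

open import Defs
open import Data.Nat using (ℕ; _*_; _^_; _≤_; _<_; NonZero)
open import Data.Nat.DivMod using (_%_)
open import Data.Nat.Divisibility using (_∣_)
open import Relation.Nullary using (¬_)
open import Relation.Binary.PropositionalEquality using (_≡_)

open import Data.Bool using (true; false)
open import Data.List using (List; []; _∷_; _++_; map; concatMap; applyUpTo; upTo; length; filter)
open import Data.List.Properties using (length-++; filter-++; filter-≐; filter-none)
open import Data.List.Relation.Unary.All using (universal)
open import Data.Nat using (zero; suc; _+_; _≟_; z≤n; s≤s; >-nonZero)
open import Data.Nat.DivMod using (m<n⇒m%n≡m; %-distribˡ-+; %-remove-+ˡ)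
open import Data.Nat.Divisibility using (_∣?_; >⇒∤; ∣m+n∣m⇒∣n; ∣-refl; ∣-trans; m∣m*n; n∣m*n; n∣m⇒m%n≡0)
open import Data.Nat.ListAction using (sum)
open import Data.Nat.Properties
open import Data.Product using (_,_)
open import Data.Vec using (Vec; []; _∷_; count)
open import Data.Vec.Properties using (count≤n)
open import Function using (_∘_)
open import Relation.Nullary using (yes; no; does; ¬?)
open import Relation.Unary using (Pred; Decidable)
open import Relation.Binary.PropositionalEquality using (_≢_; refl; sym; trans; cong; cong₂; subst; module ≡-Reasoning)

∑< : ℕ → (ℕ → ℕ) → ℕ
∑< zero    f = 0
∑< (suc k) f = f 0 + ∑< k (f ∘ suc)

∑<-cong : ∀ k {f g : ℕ → ℕ} → (∀ i → f i ≡ g i) → ∑< k f ≡ ∑< k g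
∑<-cong zero    f≗g = refl
∑<-cong (suc k) f≗g = cong₂ _+_ (f≗g 0) (∑<-cong k (f≗g ∘ suc))

∑<-vanishing : ∀ k {f : ℕ → ℕ} → (∀ i → i < k → f i ≡ 0) → ∑< k f ≡ 0
∑<-vanishing zero    f≡0 = refl
∑<-vanishing (suc k) f≡0 =
  cong₂ _+_ (f≡0 0 (s≤s z≤n)) (∑<-vanishing k (λ i i<k → f≡0 (suc i) (s≤s i<k)))

∑<-+ : ∀ a b (f : ℕ → ℕ) → ∑< (a + b) f ≡ ∑< a f + ∑< b (λ i → f (a + i))
∑<-+ zero    b f = refl
∑<-+ (suc a) b f = trans (cong (f 0 +_) (∑<-+ a b (f ∘ suc))) (sym (+-assoc (f 0) _ _))

∑<-extend : ∀ {a k} {f : ℕ → ℕ} → a ≤ k → (∀ i → a ≤ i → f i ≡ 0) → ∑< k f ≡ ∑< a f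
∑<-extend {k = k} z≤n     f≡0 = ∑<-vanishing k (λ i _ → f≡0 i z≤n)
∑<-extend         (s≤s a≤k) f≡0 = cong (_ +_) (∑<-extend a≤k (λ i a≤i → f≡0 (suc i) (s≤s a≤i)))

∑<-multiples : ∀ l .{{_ : NonZero l}} N (f : ℕ → ℕ) → (∀ x → ¬ l ∣ x → f x ≡ 0) →
               ∑< (N * l) f ≡ ∑< N (λ y → f (y * l))
∑<-multiples l         zero    f f≡0 = refl
∑<-multiples l@(suc k) (suc N) f f≡0 = begin
  ∑< (l + N * l) f                           ≡⟨ ∑<-+ l (N * l) f ⟩
  ∑< l f + ∑< (N * l) (λ i → f (l + i))      ≡⟨ cong₂ _+_ first-block rest ⟩
  f 0 + ∑< N (λ y → f (l + y * l))           ∎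
  where
  open ≡-Reasoning
  first-block : ∑< l f ≡ f 0
  first-block = trans (cong (f 0 +_) (∑<-vanishing k (λ i i<k → f≡0 (suc i) (>⇒∤ (s≤s i<k)))))
                      (+-identityʳ (f 0))
  rest : ∑< (N * l) (λ i → f (l + i)) ≡ ∑< N (λ y → f (l + y * l))
  rest = ∑<-multiples l N (λ i → f (l + i)) (λ x l∤x → f≡0 (l + x) (l∤x ∘ λ l∣l+x → ∣m+n∣m⇒∣n l∣l+x ∣-refl))

sum-map-applyUpTo : ∀ (g h : ℕ → ℕ) k → sum (map g (applyUpTo h k)) ≡ ∑< k (g ∘ h)
sum-map-applyUpTo g h zero    = refl
sum-map-applyUpTo g h (suc k) = cong (g (h 0) +_) (sum-map-applyUpTo g (h ∘ suc) k)

module _ {a b p} {A : Set a} {B : Set b} {P : Pred B p} (P? : Decidable P) where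

  length-filter-map : ∀ (f : A → B) xs → length (filter P? (map f xs)) ≡ length (filter (P? ∘ f) xs)
  length-filter-map f []       = refl
  length-filter-map f (x ∷ xs) with does (P? (f x))
  ... | true  = cong suc (length-filter-map f xs)
  ... | false = length-filter-map f xs

  length-filter-concatMap : ∀ (f : A → List B) xs →
    length (filter P? (concatMap f xs)) ≡ sum (map (length ∘ filter P? ∘ f) xs)
  length-filter-concatMap f []       = refl
  length-filter-concatMap f (x ∷ xs) = begin
    length (filter P? (f x ++ concatMap f xs))               ≡⟨ cong length (filter-++ P? (f x) (concatMap f xs)) ⟩
    length (filter P? (f x) ++ filter P? (concatMap f xs))   ≡⟨ length-++ (filter P? (f x)) ⟩
    length (filter P? (f x)) + length (filter P? (concatMap f xs))
      ≡⟨ cong (length (filter P? (f x)) +_) (length-filter-concatMap f xs) ⟩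
    length (filter P? (f x)) + sum (map (length ∘ filter P? ∘ f) xs) ∎
    where open ≡-Reasoning

length-filter-boxVecs : ∀ {p} {m} B {P : Pred (Vec ℕ (suc m)) p} (P? : Decidable P) →
  length (filter P? (boxVecs (suc m) B)) ≡ ∑< (suc B) (λ x → length (filter (P? ∘ (x ∷_)) (boxVecs m B)))
length-filter-boxVecs {m = m} B P? = begin
  length (filter P? (concatMap (λ x → map (x ∷_) (boxVecs m B)) (upTo (suc B))))
    ≡⟨ length-filter-concatMap P? (λ x → map (x ∷_) (boxVecs m B)) (upTo (suc B)) ⟩
  sum (map (λ x → length (filter P? (map (x ∷_) (boxVecs m B)))) (upTo (suc B)))
    ≡⟨ sum-map-applyUpTo _ (λ x → x) (suc B) ⟩
  ∑< (suc B) (λ x → length (filter P? (map (x ∷_) (boxVecs m B))))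
    ≡⟨ ∑<-cong (suc B) (λ x → length-filter-map P? (x ∷_) (boxVecs m B)) ⟩
  ∑< (suc B) (λ x → length (filter (P? ∘ (x ∷_)) (boxVecs m B))) ∎
  where open ≡-Reasoning

m≤m^n : ∀ m n .{{_ : NonZero n}} → m ≤ m ^ n
m≤m^n zero    (suc n) = z≤n
m≤m^n (suc m) (suc n) = m≤m*n (suc m) (suc m ^ n) {{m^n≢0 (suc m) n}}

∣⇒∣^ : ∀ {d m} n .{{_ : NonZero n}} → d ∣ m → d ∣ m ^ n
∣⇒∣^ {m = m} (suc n) d∣m = ∣-trans d∣m (m∣m*n (m ^ n))

^-distribʳ-* : ∀ m n o → (m * n) ^ o ≡ m ^ o * n ^ o
^-distribʳ-* m n zero    = refl
^-distribʳ-* m n (suc o) = trans (cong (m * n *_) (^-distribʳ-* m n o)) ([m*n]*[o*p]≡[m*o]*[n*p] m n (m ^ o) (n ^ o))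

module Solutions (n : ℕ) where

  -- P n m d is solutions m 0 d; the offset c records the entries already chosen, so the box
  -- stays {0,…,d} throughout the recursion.
  solutions : (m c d : ℕ) → ℕ
  solutions m c d = length (filter (λ v → c + powSum n v ≟ d) (boxVecs m d))

  solutions-suc : ∀ m c d → solutions (suc m) c d ≡ ∑< (suc d) (λ x → solutions m (c + x ^ n) d)
  solutions-suc m c d = trans (length-filter-boxVecs {m = m} d (λ v → c + powSum n v ≟ d))
    (∑<-cong (suc d) λ x → cong length
      (filter-≐ (λ v → c + powSum n (x ∷ v) ≟ d) (λ v → c + x ^ n + powSum n v ≟ d)
                ((λ {v} → trans (+-assoc c (x ^ n) (powSum n v)))
                , λ {v} → trans (sym (+-assoc c (x ^ n) (powSum n v))))
                (boxVecs m d)))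

  solutions-none : ∀ m {c d} → (∀ (v : Vec ℕ m) → c + powSum n v ≢ d) → solutions m c d ≡ 0
  solutions-none m {c} {d} never =
    cong length (filter-none (λ v → c + powSum n v ≟ d) (universal never (boxVecs m d)))

  solutions-overshoot : ∀ m {c d} x .{{_ : NonZero n}} → d < x → solutions m (c + x ^ n) d ≡ 0
  solutions-overshoot m {c} {d} x d<x = solutions-none m λ v eq → <⇒≱ d<x (begin
    x                        ≤⟨ m≤m^n x n ⟩
    x ^ n                    ≤⟨ m≤n+m (x ^ n) c ⟩
    c + x ^ n                ≤⟨ m≤m+n (c + x ^ n) (powSum n v) ⟩
    c + x ^ n + powSum n v   ≡⟨ eq ⟩
    d                        ∎)
    where open ≤-Reasoning

module PowerResidues (n l : ℕ) .{{_ : NonZero n}} .{{_ : NonZero l}}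
                     (fermat : ∀ x → ¬ l ∣ x → x ^ n % l ≡ 1 % l) where

  nonMultiples : ∀ {m} → Vec ℕ m → ℕ
  nonMultiples = count (λ x → ¬? (l ∣? x))

  powSum-mod : ∀ {m} (v : Vec ℕ m) → powSum n v % l ≡ nonMultiples v % l
  powSum-mod []      = refl
  powSum-mod (x ∷ v) with l ∣? x
  ... | yes l∣x = trans (%-remove-+ˡ (powSum n v) (∣⇒∣^ n l∣x)) (powSum-mod v)
  ... | no  l∤x = begin
    (x ^ n + powSum n v) % l                  ≡⟨ %-distribˡ-+ (x ^ n) (powSum n v) l ⟩
    (x ^ n % l + powSum n v % l) % l          ≡⟨ cong₂ (λ a b → (a + b) % l) (fermat x l∤x) (powSum-mod v) ⟩
    (1 % l + nonMultiples v % l) % l          ≡⟨ %-distribˡ-+ 1 (nonMultiples v) l ⟨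
    suc (nonMultiples v) % l                  ∎
    where open ≡-Reasoning

  powSum-∤ : ∀ {m} x (v : Vec ℕ m) → suc m < l → ¬ l ∣ x → ¬ l ∣ powSum n (x ∷ v)
  powSum-∤ x v 1+m<l l∤x l∣Σ with l ∣? x | powSum-mod (x ∷ v)
  ... | yes l∣x | _       = l∤x l∣x
  ... | no _    | Σ%l≡k%l = 0≢1+n (begin
    0                           ≡⟨ n∣m⇒m%n≡0 (powSum n (x ∷ v)) l l∣Σ ⟨
    powSum n (x ∷ v) % l        ≡⟨ Σ%l≡k%l ⟩
    suc (nonMultiples v) % l    ≡⟨ m<n⇒m%n≡m (≤-<-trans (s≤s (count≤n _ v)) 1+m<l) ⟩
    suc (nonMultiples v)        ∎)
    where open ≡-Reasoning

module Scaling (n l : ℕ) .{{_ : NonZero n}} .{{_ : NonZero l}}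
               (fermat : ∀ x → ¬ l ∣ x → x ^ n % l ≡ 1 % l) where

  open Solutions n
  open PowerResidues n l fermat

  L : ℕ
  L = l ^ n

  instance
    L≢0 : NonZero L
    L≢0 = m^n≢0 l n

  l∣*L : ∀ c → l ∣ c * L
  l∣*L c = ∣-trans (∣⇒∣^ n ∣-refl) (n∣m*n c)

  solutions-scale : ∀ m → m < l → ∀ c t → solutions m (c * L) (t * L) ≡ solutions m c t
  solutions-scale zero    _     c t = cong length
    (filter-≐ (λ v → c * L + powSum n v ≟ t * L) (λ v → c + powSum n v ≟ t)
              ((λ {v} → unscale {v}) , λ {v} → scale {v}) (boxVecs 0 t))
    where
    unscale : ∀ {v : Vec ℕ 0} → c * L + powSum n v ≡ t * L → c + powSum n v ≡ t
    unscale {[]} eq = trans (+-identityʳ c) (*-cancelʳ-≡ c t L (trans (sym (+-identityʳ (c * L))) eq))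
    scale : ∀ {v : Vec ℕ 0} → c + powSum n v ≡ t → c * L + powSum n v ≡ t * L
    scale {[]} eq = trans (+-identityʳ (c * L)) (cong (_* L) (trans (sym (+-identityʳ c)) eq))
  solutions-scale (suc m) 1+m<l c t = begin
    solutions (suc m) (c * L) (t * L)                    ≡⟨ solutions-suc m (c * L) (t * L) ⟩
    ∑< (suc (t * L)) g                                   ≡⟨ ∑<-extend (m≤m*n (suc (t * L)) l) (λ x → solutions-overshoot m x) ⟨
    ∑< (suc (t * L) * l) g                               ≡⟨ ∑<-multiples l (suc (t * L)) g g-off-multiples ⟩
    ∑< (suc (t * L)) (λ y → g (y * l))                   ≡⟨ ∑<-cong (suc (t * L)) g-on-multiples ⟩
    ∑< (suc (t * L)) (λ y → solutions m (c + y ^ n) t)   ≡⟨ ∑<-extend (s≤s (m≤m*n t L)) (λ y → solutions-overshoot m {c} y) ⟩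
    ∑< (suc t) (λ y → solutions m (c + y ^ n) t)         ≡⟨ solutions-suc m c t ⟨
    solutions (suc m) c t                                ∎
    where
    open ≡-Reasoning
    g : ℕ → ℕ
    g x = solutions m (c * L + x ^ n) (t * L)

    -- A solution v would make powSum n (x ∷ v) divisible by l, impossible with m + 1 < l entries.
    g-off-multiples : ∀ x → ¬ l ∣ x → g x ≡ 0
    g-off-multiples x l∤x = solutions-none m λ v eq →
      powSum-∤ x v 1+m<l l∤x (∣m+n∣m⇒∣n (subst (l ∣_) (trans (sym eq) (+-assoc (c * L) (x ^ n) (powSum n v))) (l∣*L t))
                                        (l∣*L c))

    g-on-multiples : ∀ y → g (y * l) ≡ solutions m (c + y ^ n) t
    g-on-multiples y = begin
      solutions m (c * L + (y * l) ^ n) (t * L)   ≡⟨ cong (λ k → solutions m (c * L + k) (t * L)) (^-distribʳ-* y l n) ⟩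
      solutions m (c * L + y ^ n * L) (t * L)     ≡⟨ cong (λ k → solutions m k (t * L)) (*-distribʳ-+ L c (y ^ n)) ⟨
      solutions m ((c + y ^ n) * L) (t * L)       ≡⟨ solutions-scale m (<-trans (n<1+n m) 1+m<l) (c + y ^ n) t ⟩
      solutions m (c + y ^ n) t                   ∎

proposition1 : (n m l : ℕ) → .{{_ : NonZero l}} → 2 ≤ n → 2 ≤ m → 1 < l
    → (∀ (x : ℕ) → ¬ (l ∣ x) → x ^ n % l ≡ 1 % l)
    → m < l
    → ∀ (b s : ℕ) → P n m (b * (l ^ s) ^ n) ≡ P n m b
proposition1 n m l 2≤n _ _ fermat m<l = iterate
  where
  instance
    n≢0 : NonZero n
    n≢0 = >-nonZero (≤-trans (s≤s z≤n) 2≤n)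
  open Scaling n l fermat
  open ≡-Reasoning

  iterate : ∀ b s → P n m (b * (l ^ s) ^ n) ≡ P n m b
  iterate b zero    = cong (P n m) (trans (cong (b *_) (^-zeroˡ n)) (*-identityʳ b))
  iterate b (suc s) = begin
    P n m (b * (l * l ^ s) ^ n)   ≡⟨ cong (λ k → P n m (b * k)) (^-distribʳ-* l (l ^ s) n) ⟩
    P n m (b * (L * (l ^ s) ^ n)) ≡⟨ cong (P n m) (*-assoc b L ((l ^ s) ^ n)) ⟨
    P n m (b * L * (l ^ s) ^ n)   ≡⟨ iterate (b * L) s ⟩
    P n m (b * L)                 ≡⟨ solutions-scale m m<l 0 b ⟩
    P n m b                       ∎
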